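{- Suppose all tiles of a pentagonal tiling of a compact connected surface without boundary are non-degenerate, and it is possible to label some vertices by $\circ$ such that each tile has exactly one $\circ$-vertex and its other four vertices have degree $3$. Then the surface is orientable, and (for a suitable orientation) the tiling is the pentagonal subdivision $T(5)$ of some tiling $T$.
   Context: A tiling of a compact connected surface without boundary is a graph embedded in the surface such that the complementary regions (tiles) are open disks; tilings are edge-to-edge, every vertex has degree at least $3$, every tile has at least $3$ edges, and tiles may be degenerate (boundary not a simple closed curve); a polygon is non-degenerate if its boundary is a simple closed curve. A pentagonal tiling has $5$ edges along each tile boundary. Pentagonal subdivision: let $T$ be a tiling of an oriented surface. Divide each edge of $T$ into three segments by two dividing points. For a tile $t$ and an edge $e$ on its boundary, traverse $e$ in the direction induced by the orientation of $\partial t$ and call the dividing point met first the first dividing point of $e$ from the viewpoint of $t$. Choose a center point in each tile $t$ and join it to the first dividing point (from the viewpoint of $t$) of each edge of $t$, for every pair $(t,e)$. The resulting pentagonal tiling is the pentagonal subdivision $T(5)$. -}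

module Defs where

open import Data.Nat using (ℕ; _≤_; _*_)
open import Data.Bool using (Bool; true; false; not)
open import Data.Fin using (Fin; zero; suc)
open import Data.List using (List; []; _∷_; length)
open import Data.List.Membership.Propositional using (_∈_)
open import Data.List.Relation.Unary.Unique.Propositional using (Unique)
open import Data.Product using (Σ; ∃; ∃-syntax; _×_; _,_)
open import Data.Sum using (_⊎_)
open import Relation.Binary.PropositionalEquality using (_≡_; _≢_)
open import Relation.Nullary using (¬_)

-- Orbits of a point under the group generated by a list of
-- (invertible) maps.  On a finite carrier with involutions / permutations
-- forward reachability is the orbit relation.

data Orbit {A : Set} (fs : List (A → A)) (x : A) : A → Set where
  here : Orbit fs x x
  step : ∀ {y f} → f ∈ fs → Orbit fs x y → Orbit fs x (f y)

HasSize : {A : Set} → (A → Set) → ℕ → Set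
HasSize {A} P k =
  Σ (List A) λ xs → Unique xs × (∀ y → (y ∈ xs → P y) × (P y → y ∈ xs)) × length xs ≡ k

-- Generalized maps (flag representation of a graph cellularly embedded in
-- a closed surface, orientable or not).  Flags = (vertex, edge, tile)
-- incidences.  r0 changes the vertex, r1 the edge, r2 the tile.

record GMap (A : Set) : Set where
  field
    r0 r1 r2 : A → A

module _ {A : Set} (G : GMap A) where
  open GMap G

  IsGMap : Set
  IsGMap =
    (∀ x → r0 (r0 x) ≡ x) × (∀ x → r1 (r1 x) ≡ x) × (∀ x → r2 (r2 x) ≡ x) ×
    (∀ x → r0 x ≢ x) × (∀ x → r1 x ≢ x) × (∀ x → r2 x ≢ x) ×
    (∀ x → r0 (r2 x) ≡ r2 (r0 x)) × (∀ x → r0 (r2 x) ≢ x)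

  Connected : Set
  Connected = ∀ x y → Orbit (r0 ∷ r1 ∷ r2 ∷ []) x y

  SameVertex : A → A → Set
  SameVertex = Orbit (r1 ∷ r2 ∷ [])

  SameTile : A → A → Set
  SameTile = Orbit (r0 ∷ r1 ∷ [])

  -- the vertex of flag x has degree k (a vertex of degree k carries 2k flags)
  Degree : A → ℕ → Set
  Degree x k = HasSize (SameVertex x) (2 * k)

  TileEdges : A → ℕ → Set
  TileEdges x k = HasSize (SameTile x) (2 * k)

  IsTiling : Set
  IsTiling = IsGMap × Connected ×
             (∀ x → ∃[ k ] (3 ≤ k × Degree x k)) ×
             (∀ x → ∃[ k ] (3 ≤ k × TileEdges x k))

  Pentagonal : Set
  Pentagonal = ∀ x → TileEdges x 5

  -- the tile of flag x is non-degenerate: its boundary is a simple closed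
  -- curve, i.e. no vertex occurs at two different corners of the tile
  -- (a corner of the tile is a pair {y , r1 y} of flags of the tile).
  NonDegenerateTile : A → Set
  NonDegenerateTile x = ∀ y z → SameTile x y → SameTile x z →
                        SameVertex y z → (z ≡ y) ⊎ (z ≡ r1 y)

  Orientable : Set
  Orientable = Σ (A → Bool) λ c →
    (∀ x → c (r0 x) ≢ c x) × (∀ x → c (r1 x) ≢ c x) × (∀ x → c (r2 x) ≢ c x)

  CircLabelling : (A → Bool) → Set
  CircLabelling ℓ =
    (∀ x y → SameVertex x y → ℓ x ≡ ℓ y) ×
    (∀ x → Σ A λ y → SameTile x y × ℓ y ≡ true ×
             (∀ z → SameTile x z → ℓ z ≡ true → SameVertex y z)) ×
    (∀ x z → SameTile x z → ℓ z ≡ false → Degree z 3)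

record GIso {A B : Set} (G : GMap A) (H : GMap B) : Set where
  open GMap
  field
    to   : A → B
    from : B → A
    from-to : ∀ x → from (to x) ≡ x
    to-from : ∀ y → to (from y) ≡ y
    to-r0 : ∀ x → to (r0 G x) ≡ r0 H (to x)
    to-r1 : ∀ x → to (r1 G x) ≡ r1 H (to x)
    to-r2 : ∀ x → to (r2 G x) ≡ r2 H (to x)

-- Oriented maps (tilings of oriented surfaces) by darts:
-- σ = counterclockwise rotation of darts around their tail vertex,
-- σ⁻ its inverse, α = reversal of darts.  Tiles are orbits of σ⁻ ∘ α
-- (boundary of the tile to the left of a dart, traversed with the
-- induced orientation).

record OMap (D : Set) : Set where
  field
    σ σ⁻ α : D → D

IsOMap : {D : Set} → OMap D → Set
IsOMap T = (∀ d → σ (σ⁻ d) ≡ d) × (∀ d → σ⁻ (σ d) ≡ d) ×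
           (∀ d → α (α d) ≡ d) × (∀ d → α d ≢ d)
  where open OMap T

-- flags of an oriented map: (d , b), b says on which side of d the tile is
toGMap : {D : Set} → OMap D → GMap (D × Bool)
toGMap {D} T = record { r0 = g0 ; r1 = g1 ; r2 = g2 }
  where
  open OMap T
  g0 g1 g2 : D × Bool → D × Bool
  g0 (d , b) = α d , not b
  g1 (d , true) = σ d , false
  g1 (d , false) = σ⁻ d , true
  g2 (d , b) = d , not b

-- For a dart d of T (from v to w, tile t to
-- its left) let q(d) be the dividing point of its edge nearest to v; it is
-- the first dividing point of the edge from the viewpoint of t, and it is
-- joined to the centre z(t).  Darts of T(5) attached to d:
--   (d,0) : v → q(d)          (d,1) : q(d) → v
--   (d,2) : q(d) → q(α d)     (middle third of the edge; reverse is (α d,2))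
--   (d,3) : q(d) → z(t)       (d,4) : z(t) → q(d)

pentSub : {D : Set} → OMap D → OMap (D × Fin 5)
pentSub {D} T = record { σ = s ; σ⁻ = s⁻ ; α = a }
  where
  open OMap T
  s s⁻ a : D × Fin 5 → D × Fin 5
  s (d , zero) = σ d , zero
  s (d , suc zero) = d , suc (suc zero)
  s (d , suc (suc zero)) = d , suc (suc (suc zero))
  s (d , suc (suc (suc zero))) = d , suc zero
  s (d , suc (suc (suc (suc zero)))) = σ⁻ (α d) , suc (suc (suc (suc zero)))
  s⁻ (d , zero) = σ⁻ d , zero
  s⁻ (d , suc zero) = d , suc (suc (suc zero))
  s⁻ (d , suc (suc zero)) = d , suc zero
  s⁻ (d , suc (suc (suc zero))) = d , suc (suc zero)
  s⁻ (d , suc (suc (suc (suc zero)))) = α (σ d) , suc (suc (suc (suc zero)))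
  a (d , zero) = d , suc zero
  a (d , suc zero) = d , zero
  a (d , suc (suc zero)) = α d , suc (suc zero)
  a (d , suc (suc (suc zero))) = d , suc (suc (suc (suc zero)))
  a (d , suc (suc (suc (suc zero)))) = d , suc (suc (suc zero))

{-# OPTIONS --safe #-}
-- A pentagon of M is a cycle of ten flags under r0 and r1; by non-degeneracy it passes once
-- through its ∘-vertex, and its other four vertices have degree 3.  Call a ∘-flag positive when
-- the third edge at the corner 2 of its pentagon (counted from the ∘-corner) ends in a ∘-vertex.
-- Inspecting the neighbouring pentagons shows that r1 and r2 both reverse positivity at ∘-flags,
-- so the positive ∘-flags are permuted by σ = r1 r2 and by the reversal across that third edge:
-- they are the darts of an oriented map T.  Each dart of T accounts for the ten flags of one
-- pentagon, which identifies the flags of T(5) with those of M; M inherits the orientation of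
-- T(5), and T is a tiling because the vertices and tile centres of T are vertices of T(5).
module Submission where

open import Defs
open import Algebra.Definitions using (Involutive)
open import Data.Bool using (Bool; true; false; not)
import Data.Bool.Properties as Boolₚ
open import Data.Empty using (⊥; ⊥-elim)
open import Data.Fin as Fin using (Fin; toℕ)
import Data.Fin.Properties as Finₚ
open import Data.List using (List; []; _∷_; length; lookup; map; filter; allFin)
open import Data.List.Properties using (length-map; map-∘; map-id-local)
open import Data.List.Membership.Propositional using (_∈_)
open import Data.List.Membership.Propositional.Properties
  using (∈-lookup; ∈-map⁺; ∈-map⁻; ∈-filter⁺; ∈-filter⁻; ∈-allFin)
open import Data.List.Relation.Binary.Pointwise using (Pointwise; []; _∷_)
open import Data.List.Relation.Unary.All as All using (All; []; _∷_)
open import Data.List.Relation.Unary.AllPairs using (_∷_)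
open import Data.List.Relation.Unary.Any using (here; there; index)
open import Data.List.Relation.Unary.Any.Properties using (lookup-index)
open import Data.List.Relation.Unary.Unique.Propositional using (Unique)
import Data.List.Relation.Unary.Unique.Propositional.Properties as Uniqueₚ
open import Data.Nat using (ℕ; zero; suc; _+_; _≤_; _<_; z≤n; s≤s)
open import Data.Nat.Properties
  using (+-comm; +-suc; +-identityʳ; m≤n+m; ≤-refl; ≤-trans; ≤-antisym; n≤1+n; n<1+n; <⇒≱; <-cmp;
         m≤n⇒m≤1+n; m≤n⇒m<n∨m≡n; m≤n⇒∃[o]m+o≡n)
open import Data.Product using (Σ; ∃; ∃-syntax; _×_; _,_; proj₁; proj₂)
open import Data.Sum using (_⊎_; inj₁; inj₂)
open import Data.Unit using (⊤; tt)
open import Function using (_∘_)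
open import Relation.Binary.Definitions using (tri<; tri≈; tri>)
open import Relation.Binary.PropositionalEquality
open import Relation.Nullary using (contradiction; _×-dec_)
open import Relation.Unary using (Decidable)

module _ {A : Set} {fs : List (A → A)} where

  orbit-step : ∀ {f} → f ∈ fs → ∀ x → Orbit fs x (f x)
  orbit-step f∈fs x = step f∈fs here

  orbit-trans : ∀ {x y z} → Orbit fs x y → Orbit fs y z → Orbit fs x z
  orbit-trans p here = p
  orbit-trans p (step f∈fs q) = step f∈fs (orbit-trans p q)

  orbit-sym : (∀ {f} → f ∈ fs → Involutive _≡_ f) → ∀ {x y} → Orbit fs x y → Orbit fs y x
  orbit-sym inv here = here
  orbit-sym inv (step {y} f∈fs p) =
    orbit-trans (subst (Orbit fs _) (inv f∈fs y) (orbit-step f∈fs _)) (orbit-sym inv p)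

  orbit-preserves : (I : A → Set) → All (λ f → ∀ {x} → I x → I (f x)) fs →
                    ∀ {x y} → I x → Orbit fs x y → I y
  orbit-preserves I closed Ix here = Ix
  orbit-preserves I closed Ix (step f∈fs o) = All.lookup closed f∈fs (orbit-preserves I closed Ix o)

pointwise-∈ : ∀ {A B : Set} {R : A → B → Set} {xs ys x} →
              Pointwise R xs ys → x ∈ xs → ∃ λ y → y ∈ ys × R x y
pointwise-∈ (r ∷ _) (here refl) = _ , here refl , r
pointwise-∈ (_ ∷ rs) (there x∈xs) with pointwise-∈ rs x∈xs
... | y , y∈ys , r = y , there y∈ys , r

module _ {A B : Set} {fs : List (A → A)} {gs : List (B → B)} (φ : A → B) where

  orbit-imageᴵ : (I : A → Set) → All (λ f → ∀ {x} → I x → I (f x)) fs →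
                 (∀ {f} → f ∈ fs → ∀ {x} → I x → Orbit gs (φ x) (φ (f x))) →
                 ∀ {x y} → I x → Orbit fs x y → Orbit gs (φ x) (φ y)
  orbit-imageᴵ I closed path Ix here = here
  orbit-imageᴵ I closed path Ix (step f∈fs o) =
    orbit-trans (orbit-imageᴵ I closed path Ix o) (path f∈fs (orbit-preserves I closed Ix o))

  private
    everywhere : All (λ f → ∀ {x : A} → ⊤ → ⊤) fs
    everywhere = All.universal (λ _ {_} _ → tt) fs

  orbit-image : (∀ {f} → f ∈ fs → ∀ x → Orbit gs (φ x) (φ (f x))) →
                ∀ {x y} → Orbit fs x y → Orbit gs (φ x) (φ y)
  orbit-image path = orbit-imageᴵ (λ _ → ⊤) everywhere (λ f∈fs {x} _ → path f∈fs x) tt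

  Intertwines : (A → Set) → (A → A) → (B → B) → Set
  Intertwines I f g = ∀ {x} → I x → φ (f x) ≡ g (φ x)

  orbit-mapᴵ : (I : A → Set) → All (λ f → ∀ {x} → I x → I (f x)) fs →
               Pointwise (Intertwines I) fs gs →
               ∀ {x y} → I x → Orbit fs x y → Orbit gs (φ x) (φ y)
  orbit-mapᴵ I closed comm = orbit-imageᴵ I closed traced
    where
    traced : ∀ {f} → f ∈ fs → ∀ {x} → I x → Orbit gs (φ x) (φ (f x))
    traced f∈fs Ix with pointwise-∈ comm f∈fs
    ... | g , g∈gs , e = subst (Orbit gs _) (sym (e Ix)) (orbit-step g∈gs _)

  orbit-map : Pointwise (Intertwines (λ _ → ⊤)) fs gs →
              ∀ {x y} → Orbit fs x y → Orbit gs (φ x) (φ y)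
  orbit-map comm = orbit-mapᴵ (λ _ → ⊤) everywhere comm tt

lookup-injective : ∀ {A : Set} {xs : List A} → Unique xs →
                   ∀ i j → lookup xs i ≡ lookup xs j → i ≡ j
lookup-injective {xs = _ ∷ _} _ Fin.zero Fin.zero _ = refl
lookup-injective {xs = _ ∷ _} (x∉ ∷ _) Fin.zero (Fin.suc j) e = ⊥-elim (All.lookup x∉ (∈-lookup j) e)
lookup-injective {xs = _ ∷ _} (x∉ ∷ _) (Fin.suc i) Fin.zero e = ⊥-elim (All.lookup x∉ (∈-lookup i) (sym e))
lookup-injective {xs = _ ∷ _} (_ ∷ u) (Fin.suc i) (Fin.suc j) e = cong Fin.suc (lookup-injective u i j e)

length-≤-cover : ∀ {A : Set} {xs : List A} {p} (f : Fin p → A) → Unique xs →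
                 (∀ {x} → x ∈ xs → ∃ λ i → f i ≡ x) → length xs ≤ p
length-≤-cover {xs = xs} f u cover = Finₚ.injective⇒≤ injective
  where
  preimage : Fin (length xs) → _
  preimage i = proj₁ (cover (∈-lookup i))
  injective : ∀ {i j} → preimage i ≡ preimage j → i ≡ j
  injective {i} {j} e = lookup-injective u i j (begin
    lookup xs i          ≡⟨ proj₂ (cover (∈-lookup i)) ⟨
    f (preimage i)       ≡⟨ cong f e ⟩
    f (preimage j)       ≡⟨ proj₂ (cover (∈-lookup j)) ⟩
    lookup xs j          ∎)
    where open ≡-Reasoning

HasSize-transport : ∀ {A B : Set} {P : A → Set} {Q : B → Set} (π : A → B) (ι : B → A) →
  (∀ {a} → P a → Q (π a)) → (∀ {b} → Q b → P (ι b)) →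
  (∀ {a} → P a → ι (π a) ≡ a) → (∀ {b} → Q b → π (ι b) ≡ b) →
  ∀ {k} → HasSize P k → HasSize Q k
HasSize-transport {P = P} {Q} π ι P⇒Q Q⇒P ιπ πι (xs , u , mem , len) =
  map π xs , unique , (λ y → image⇒Q , Q⇒image) , trans (length-map π xs) len
  where
  ιπxs : map ι (map π xs) ≡ xs
  ιπxs = trans (sym (map-∘ xs)) (map-id-local (All.tabulate (λ x∈ → ιπ (proj₁ (mem _) x∈))))
  unique : Unique (map π xs)
  unique = Uniqueₚ.map⁻ (subst Unique (sym ιπxs) u)
  image⇒Q : ∀ {y} → y ∈ map π xs → Q y
  image⇒Q y∈ with ∈-map⁻ π y∈
  ... | x , x∈ , refl = P⇒Q (proj₁ (mem x) x∈)
  Q⇒image : ∀ {y} → Q y → y ∈ map π xs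
  Q⇒image Qy = subst (_∈ map π xs) (πι Qy) (∈-map⁺ π (proj₂ (mem _) (Q⇒P Qy)))

double : ℕ → ℕ
double zero = zero
double (suc t) = suc (suc (double t))

double-mono-≤ : ∀ {s t} → s ≤ t → double s ≤ double t
double-mono-≤ z≤n = z≤n
double-mono-≤ (s≤s s≤t) = s≤s (s≤s (double-mono-≤ s≤t))

data Parity : ℕ → Set where
  even : ∀ t → Parity (double t)
  odd  : ∀ t → Parity (suc (double t))

parity : ∀ n → Parity n
parity zero = even 0
parity (suc n) with parity n
... | even t = odd t
... | odd t = even (suc t)

involutive-flip : ∀ {A : Set} {f : A → A} → Involutive _≡_ f → ∀ {x y} → y ≡ f x → f y ≡ x
involutive-flip {f = f} inv {x} refl = inv x

module AlternatingWalk {A : Set} (a b : A → A) (a-inv : Involutive _≡_ a) (b-inv : Involutive _≡_ b)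
                       (a-free : ∀ x → a x ≢ x) (b-free : ∀ x → b x ≢ x) where

  Orbitᵃᵇ : A → A → Set
  Orbitᵃᵇ = Orbit (a ∷ b ∷ [])

  ab-involutive : ∀ {f} → f ∈ (a ∷ b ∷ []) → Involutive _≡_ f
  ab-involutive (here refl) = a-inv
  ab-involutive (there (here refl)) = b-inv

  letter : ℕ → A → A
  letter zero = a
  letter (suc zero) = b
  letter (suc (suc k)) = letter k

  walk : A → ℕ → A
  walk y zero = y
  walk y (suc k) = letter k (walk y k)

  letter-involutive : ∀ k → Involutive _≡_ (letter k)
  letter-involutive zero = a-inv
  letter-involutive (suc zero) = b-inv
  letter-involutive (suc (suc k)) = letter-involutive k

  letter-free : ∀ k x → letter k x ≢ x
  letter-free zero = a-free
  letter-free (suc zero) = b-free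
  letter-free (suc (suc k)) = letter-free k

  letter-∈ : ∀ k → letter k ∈ (a ∷ b ∷ [])
  letter-∈ zero = here refl
  letter-∈ (suc zero) = there (here refl)
  letter-∈ (suc (suc k)) = letter-∈ k

  letter-double+ : ∀ t k → letter (double t + k) ≡ letter k
  letter-double+ zero k = refl
  letter-double+ (suc t) k = letter-double+ t k

  letter-even : ∀ t → letter (double t) ≡ a
  letter-even zero = refl
  letter-even (suc t) = letter-even t

  letter-odd : ∀ t → letter (suc (double t)) ≡ b
  letter-odd zero = refl
  letter-odd (suc t) = letter-odd t

  walk-in-orbit : ∀ y k → Orbitᵃᵇ y (walk y k)
  walk-in-orbit y zero = here
  walk-in-orbit y (suc k) = step (letter-∈ k) (walk-in-orbit y k)

  walk-back : ∀ y k → walk y k ≡ letter k (walk y (suc k))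
  walk-back y k = sym (letter-involutive k (walk y k))

  walk-even : ∀ y s → walk y (suc (double s)) ≡ a (walk y (double s))
  walk-even y s = cong (λ f → f (walk y (double s))) (letter-even s)

  walk-odd : ∀ y s → walk y (double (suc s)) ≡ b (walk y (suc (double s)))
  walk-odd y s = cong (λ f → f (walk y (suc (double s)))) (letter-odd s)

  walk-cancel : ∀ y i j → letter i ≡ letter j → walk y (suc i) ≡ walk y (suc j) → walk y i ≡ walk y j
  walk-cancel y i j e h = begin
    walk y i                          ≡⟨ walk-back y i ⟩
    letter i (walk y (suc i))         ≡⟨ cong₂ (λ f z → f z) e h ⟩
    letter j (walk y (suc j))         ≡⟨ walk-back y j ⟨
    walk y j                          ∎
    where open ≡-Reasoning

  no-odd-return : ∀ y t i → walk y i ≢ walk y (suc (double t + i))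
  no-odd-return y zero i h = letter-free i (walk y i) (sym h)
  no-odd-return y (suc t) i h = no-odd-return y t (suc i) (begin
    walk y (suc i)                    ≡⟨ cong (letter i) h ⟩
    letter i (walk y (suc m))         ≡⟨ cong (λ f → f (walk y (suc m))) (letter-double+ t i) ⟨
    letter m (walk y (suc m))         ≡⟨ walk-back y m ⟨
    walk y m                          ≡⟨ cong (λ k → walk y (suc k)) (+-suc (double t) i) ⟨
    walk y (suc (double t + suc i))   ∎)
    where
    m = suc (suc (double t + i))
    open ≡-Reasoning

  even-return : ∀ y t i → walk y i ≡ walk y (double t + i) → walk y (double t) ≡ y
  even-return y t zero h = sym (trans h (cong (walk y) (+-identityʳ (double t))))
  even-return y t (suc i) h = even-return y t i
    (walk-cancel y i (double t + i) (sym (letter-double+ t i)) (trans h (cong (walk y) (+-suc (double t) i))))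

  return-within : ∀ y {i j} → i < j → walk y i ≡ walk y j →
                  Σ ℕ λ t → walk y (double (suc t)) ≡ y × double (suc t) ≤ j
  return-within y {i} i<j h with m≤n⇒∃[o]m+o≡n i<j
  ... | o , refl with parity o
  ...   | even t = ⊥-elim (no-odd-return y t i (trans h (cong (walk y ∘ suc) (+-comm i (double t)))))
  ...   | odd t  = t , even-return y (suc t) i (trans h (cong (walk y ∘ suc) (+-comm i (suc (double t)))))
                     , s≤s (m≤n+m (suc (double t)) i)

  module _ {y t} (return : walk y (double (suc t)) ≡ y) where

    private
      cover : ∀ {x} → Orbitᵃᵇ y x →
              Σ ℕ λ s → s ≤ t × (walk y (double s) ≡ x ⊎ walk y (suc (double s)) ≡ x)
      cover here = 0 , z≤n , inj₁ refl
      cover (step (here refl) o) with cover o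
      ... | s , s≤t , inj₁ e = s , s≤t , inj₂ (trans (walk-even y s) (cong a e))
      ... | s , s≤t , inj₂ e = s , s≤t , inj₁ (sym (involutive-flip a-inv (trans (sym e) (walk-even y s))))
      cover (step (there (here refl)) o) with cover o
      ... | zero , _ , inj₁ e =
        t , ≤-refl , inj₂ (sym (involutive-flip b-inv (trans (sym e) (trans (sym return) (walk-odd y t)))))
      ... | suc s , s<t , inj₁ e =
        s , ≤-trans (n≤1+n s) s<t , inj₂ (sym (involutive-flip b-inv (trans (sym e) (walk-odd y s))))
      ... | s , s≤t , inj₂ e with m≤n⇒m<n∨m≡n s≤t
      ...   | inj₁ s<t = suc s , s<t , inj₁ (trans (walk-odd y s) (cong b e))
      ...   | inj₂ refl = 0 , z≤n , inj₁ (trans (sym return) (trans (walk-odd y s) (cong b e)))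

    walk-covers-orbit : ∀ {x} → Orbitᵃᵇ y x → Σ ℕ λ k → k < double (suc t) × walk y k ≡ x
    walk-covers-orbit o with cover o
    ... | s , s≤t , inj₁ e = double s , s≤s (m≤n⇒m≤1+n (double-mono-≤ s≤t)) , e
    ... | s , s≤t , inj₂ e = suc (double s) , s≤s (s≤s (double-mono-≤ s≤t)) , e

  module _ {y N} (orbit-size : HasSize (Orbitᵃᵇ y) N) where

    private
      xs = proj₁ orbit-size
      mem = proj₁ (proj₂ (proj₂ orbit-size))
      len = proj₂ (proj₂ (proj₂ orbit-size))

      size≤return : ∀ {t} → walk y (double (suc t)) ≡ y → N ≤ double (suc t)
      size≤return return = subst (_≤ _) len (length-≤-cover (walk y ∘ toℕ) (proj₁ (proj₂ orbit-size)) covered)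
        where
        covered : ∀ {x} → x ∈ xs → ∃ λ (k : Fin _) → walk y (toℕ k) ≡ x
        covered x∈xs with walk-covers-orbit return (proj₁ (mem _) x∈xs)
        ... | k , k< , e = Fin.fromℕ< k< , trans (cong (walk y) (Finₚ.toℕ-fromℕ< k<)) e

      no-early-return : ∀ {i j} → i < j → j < N → walk y i ≢ walk y j
      no-early-return i<j j<N h with return-within y i<j h
      ... | t , return , ≤j = <⇒≱ j<N (≤-trans (size≤return return) ≤j)

      position : ∀ k → walk y k ∈ xs
      position k = proj₂ (mem _) (walk-in-orbit y k)

      -- By pigeonhole the walk repeats within N steps; the return is then even, hence a return to
      -- y, and a return to y after p steps covers the orbit, so that N ≤ p.
      abstract
        returns : Σ ℕ λ t → walk y (double (suc t)) ≡ y × double (suc t) ≡ N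
        returns with Finₚ.pigeonhole (n<1+n (length xs)) (λ k → index (position (toℕ k)))
        ... | i , j , i<j , e with return-within y i<j (begin
              walk y (toℕ i)                       ≡⟨ lookup-index (position (toℕ i)) ⟩
              lookup xs (index (position (toℕ i))) ≡⟨ cong (lookup xs) e ⟩
              lookup xs (index (position (toℕ j))) ≡⟨ lookup-index (position (toℕ j)) ⟨
              walk y (toℕ j)                       ∎)
          where open ≡-Reasoning
        ...   | t , return , ≤j = t , return ,
                ≤-antisym (subst (_ ≤_) len (≤-trans ≤j (Finₚ.toℕ≤pred[n] j))) (size≤return return)

    walk-period : walk y N ≡ y
    walk-period = let _ , return , ≡N = returns in subst (λ k → walk y k ≡ y) ≡N return

    walk-injective : ∀ {i j} → i < N → j < N → walk y i ≡ walk y j → i ≡ j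
    walk-injective {i} {j} i<N j<N h with <-cmp i j
    ... | tri≈ _ i≡j _ = i≡j
    ... | tri< i<j _ _ = ⊥-elim (no-early-return i<j j<N h)
    ... | tri> _ _ j<i = ⊥-elim (no-early-return j<i i<N (sym h))

    walk-onto : ∀ {x} → Orbitᵃᵇ y x → Σ ℕ λ k → k < N × walk y k ≡ x
    walk-onto o = let _ , return , ≡N = returns in
      subst (λ p → Σ ℕ λ k → k < p × walk y k ≡ _) ≡N (walk-covers-orbit return o)

module _ {A B : Set} {G : GMap A} {H : GMap B} where
  open GMap

  GIso-sym : GIso G H → GIso H G
  GIso-sym iso = record
    { to = from ; from = to ; from-to = to-from ; to-from = from-to
    ; to-r0 = from-intertwines {r0 G} to-r0
    ; to-r1 = from-intertwines {r1 G} to-r1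
    ; to-r2 = from-intertwines {r2 G} to-r2
    }
    where
    open GIso iso
    from-intertwines : ∀ {f g} → (∀ x → to (f x) ≡ g (to x)) → ∀ y → from (g y) ≡ f (from y)
    from-intertwines {f} {g} comm y = begin
      from (g y)              ≡⟨ cong (from ∘ g) (to-from y) ⟨
      from (g (to (from y)))  ≡⟨ cong from (comm (from y)) ⟨
      from (to (f (from y)))  ≡⟨ from-to _ ⟩
      f (from y)              ∎
      where open ≡-Reasoning

module GIsoOrbits {A B : Set} {G : GMap A} {H : GMap B} (iso : GIso G H) where
  open GMap
  open GIso iso

  to-injective : ∀ {x y} → to x ≡ to y → x ≡ y
  to-injective {x} {y} e = trans (sym (from-to x)) (trans (cong from e) (from-to y))

  SameVertex-to : ∀ {x y} → SameVertex G x y → SameVertex H (to x) (to y)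
  SameVertex-to = orbit-map to ((λ _ → to-r1 _) ∷ (λ _ → to-r2 _) ∷ [])

  SameTile-to : ∀ {x y} → SameTile G x y → SameTile H (to x) (to y)
  SameTile-to = orbit-map to ((λ _ → to-r0 _) ∷ (λ _ → to-r1 _) ∷ [])

  Connected-to : ∀ {x y} → Orbit (r0 G ∷ r1 G ∷ r2 G ∷ []) x y →
                 Orbit (r0 H ∷ r1 H ∷ r2 H ∷ []) (to x) (to y)
  Connected-to = orbit-map to ((λ _ → to-r0 _) ∷ (λ _ → to-r1 _) ∷ (λ _ → to-r2 _) ∷ [])

module _ {A B : Set} {G : GMap A} {H : GMap B} (iso : GIso G H) where
  open GMap
  open GIso iso
  open GIsoOrbits iso
  private
    module Inv = GIso (GIso-sym iso)
    module InvOrbits = GIsoOrbits (GIso-sym iso)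

  Orientable-transport : Orientable G → Orientable H
  Orientable-transport (c , flip0 , flip1 , flip2) =
      c ∘ from
    , flips (r0 G) (r0 H) Inv.to-r0 flip0
    , flips (r1 G) (r1 H) Inv.to-r1 flip1
    , flips (r2 G) (r2 H) Inv.to-r2 flip2
    where
    flips : ∀ f g → (∀ y → from (g y) ≡ f (from y)) → (∀ x → c (f x) ≢ c x) →
            ∀ y → c (from (g y)) ≢ c (from y)
    flips _ _ comm flip y = flip (from y) ∘ trans (cong c (sym (comm y)))

  Degree-reflect : ∀ {x k} → Degree H (to x) k → Degree G x k
  Degree-reflect {x} = HasSize-transport from to
    (subst (λ z → SameVertex G z _) (from-to x) ∘ InvOrbits.SameVertex-to) SameVertex-to
    (λ _ → to-from _) (λ _ → from-to _)

  TileEdges-reflect : ∀ {x k} → TileEdges H (to x) k → TileEdges G x k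
  TileEdges-reflect {x} = HasSize-transport from to
    (subst (λ z → SameTile G z _) (from-to x) ∘ InvOrbits.SameTile-to) SameTile-to
    (λ _ → to-from _) (λ _ → from-to _)

  IsTiling-reflect : IsTiling H → IsTiling G
  IsTiling-reflect ((inv0 , inv1 , inv2 , free0 , free1 , free2 , comm02 , free02) , connected , degrees , edges) =
    ( involutive (r0 G) (r0 H) to-r0 inv0
    , involutive (r1 G) (r1 H) to-r1 inv1
    , involutive (r2 G) (r2 H) to-r2 inv2
    , fixpoint-free (r0 G) (r0 H) to-r0 free0
    , fixpoint-free (r1 G) (r1 H) to-r1 free1
    , fixpoint-free (r2 G) (r2 H) to-r2 free2
    , (λ x → to-injective (trans (to-r02 x) (trans (comm02 (to x)) (sym (to-r20 x)))))
    , fixpoint-free (r0 G ∘ r2 G) (r0 H ∘ r2 H) to-r02 free02 )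
    , (λ x y → subst₂ (Orbit _) (from-to x) (from-to y) (InvOrbits.Connected-to (connected (to x) (to y))))
    , (λ x → let k , 3≤k , deg = degrees (to x) in k , 3≤k , Degree-reflect {k = k} deg)
    , (λ x → let k , 3≤k , deg = edges (to x) in k , 3≤k , TileEdges-reflect {k = k} deg)
    where
    to-r02 : ∀ x → to (r0 G (r2 G x)) ≡ r0 H (r2 H (to x))
    to-r02 x = trans (to-r0 _) (cong (r0 H) (to-r2 x))
    to-r20 : ∀ x → to (r2 G (r0 G x)) ≡ r2 H (r0 H (to x))
    to-r20 x = trans (to-r2 _) (cong (r2 H) (to-r0 x))
    involutive : ∀ f g → (∀ x → to (f x) ≡ g (to x)) → Involutive _≡_ g → Involutive _≡_ f
    involutive f g comm inv x = to-injective (begin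
      to (f (f x))   ≡⟨ comm (f x) ⟩
      g (to (f x))   ≡⟨ cong g (comm x) ⟩
      g (g (to x))   ≡⟨ inv (to x) ⟩
      to x           ∎)
      where open ≡-Reasoning
    fixpoint-free : ∀ f g → (∀ x → to (f x) ≡ g (to x)) → (∀ y → g y ≢ y) → ∀ x → f x ≢ x
    fixpoint-free _ _ comm free x e = free (to x) (trans (sym (comm x)) (cong to e))

pattern i0 = Fin.zero
pattern i1 = Fin.suc Fin.zero
pattern i2 = Fin.suc (Fin.suc Fin.zero)
pattern i3 = Fin.suc (Fin.suc (Fin.suc Fin.zero))
pattern i4 = Fin.suc (Fin.suc (Fin.suc (Fin.suc Fin.zero)))

not-≢ : ∀ b → not b ≢ b
not-≢ b = Boolₚ.not-¬ refl ∘ sym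

module _ {D : Set} (T : OMap D) where
  open GMap (toGMap T)

  toGMap-orientable : Orientable (toGMap T)
  toGMap-orientable = proj₂ , (λ (_ , b) → not-≢ b) , flip1 , (λ (_ , b) → not-≢ b)
    where
    flip1 : ∀ x → proj₂ (r1 x) ≢ proj₂ x
    flip1 (_ , true) ()
    flip1 (_ , false) ()

  module _ (isOMap : IsOMap T) where
    open OMap T
    private
      σσ⁻ = proj₁ isOMap
      σ⁻σ = proj₁ (proj₂ isOMap)
      αα = proj₁ (proj₂ (proj₂ isOMap))
      α-free = proj₂ (proj₂ (proj₂ isOMap))

    toGMap-isGMap : IsGMap (toGMap T)
    toGMap-isGMap = (λ (d , b) → cong₂ _,_ (αα d) (Boolₚ.not-involutive b))
                  , inv1
                  , (λ (d , b) → cong (d ,_) (Boolₚ.not-involutive b))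
                  , (λ (_ , b) → not-≢ b ∘ cong proj₂)
                  , free1
                  , (λ (_ , b) → not-≢ b ∘ cong proj₂)
                  , (λ _ → refl)
                  , (λ (d , _) → α-free d ∘ cong proj₁)
      where
      inv1 : ∀ x → r1 (r1 x) ≡ x
      inv1 (d , true) = cong (_, true) (σ⁻σ d)
      inv1 (d , false) = cong (_, false) (σσ⁻ d)
      free1 : ∀ x → r1 x ≢ x
      free1 (_ , true) ()
      free1 (_ , false) ()

    private
      GT = toGMap T
      GP = toGMap (pentSub T)
      module GT = GMap GT
      module GP = GMap GP

    vertex-flag centre-flag : D × Bool → (D × Fin 5) × Bool
    vertex-flag (d , b) = (d , i0) , b
    centre-flag (d , true) = (d , i4) , true
    centre-flag (d , false) = (σ⁻ d , i4) , false

    private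
      AtVertex AtCentre : (D × Fin 5) × Bool → Set
      AtVertex ((_ , i) , _) = i ≡ i0
      AtCentre ((_ , i) , _) = i ≡ i4

      vertex-flag⁻¹ centre-flag⁻¹ : (D × Fin 5) × Bool → D × Bool
      vertex-flag⁻¹ ((d , _) , b) = d , b
      centre-flag⁻¹ ((d , _) , true) = d , true
      centre-flag⁻¹ ((d , _) , false) = σ d , false

      vertex-closed : All (λ f → ∀ {x} → AtVertex x → AtVertex (f x)) (GP.r1 ∷ GP.r2 ∷ [])
      vertex-closed = (λ {x} → closed1 x) ∷ (λ {x} → closed2 x) ∷ []
        where
        closed1 : ∀ x → AtVertex x → AtVertex (GP.r1 x)
        closed1 ((_ , i0) , true) refl = refl
        closed1 ((_ , i0) , false) refl = refl
        closed2 : ∀ x → AtVertex x → AtVertex (GP.r2 x)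
        closed2 ((_ , i0) , _) refl = refl

      centre-closed : All (λ f → ∀ {x} → AtCentre x → AtCentre (f x)) (GP.r1 ∷ GP.r2 ∷ [])
      centre-closed = (λ {x} → closed1 x) ∷ (λ {x} → closed2 x) ∷ []
        where
        closed1 : ∀ x → AtCentre x → AtCentre (GP.r1 x)
        closed1 ((_ , i4) , true) refl = refl
        closed1 ((_ , i4) , false) refl = refl
        closed2 : ∀ x → AtCentre x → AtCentre (GP.r2 x)
        closed2 ((_ , i4) , _) refl = refl

    Degree-vertex-flag : ∀ {x k} → Degree GP (vertex-flag x) k → Degree GT x k
    Degree-vertex-flag = HasSize-transport vertex-flag⁻¹ vertex-flag
      (orbit-mapᴵ vertex-flag⁻¹ AtVertex vertex-closed ((λ {x} → comm1 x) ∷ (λ {x} → comm2 x) ∷ []) refl)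
      (orbit-map vertex-flag ((λ {x} _ → comm1⁻¹ x) ∷ (λ _ → refl) ∷ []))
      (λ o → section _ (orbit-preserves AtVertex vertex-closed refl o))
      (λ _ → refl)
      where
      comm1 : ∀ x → AtVertex x → vertex-flag⁻¹ (GP.r1 x) ≡ GT.r1 (vertex-flag⁻¹ x)
      comm1 ((_ , i0) , true) refl = refl
      comm1 ((_ , i0) , false) refl = refl
      comm2 : ∀ x → AtVertex x → vertex-flag⁻¹ (GP.r2 x) ≡ GT.r2 (vertex-flag⁻¹ x)
      comm2 ((_ , i0) , _) refl = refl
      comm1⁻¹ : ∀ x → vertex-flag (GT.r1 x) ≡ GP.r1 (vertex-flag x)
      comm1⁻¹ (_ , true) = refl
      comm1⁻¹ (_ , false) = refl
      section : ∀ x → AtVertex x → vertex-flag (vertex-flag⁻¹ x) ≡ x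
      section ((_ , i0) , _) refl = refl

    TileEdges-centre-flag : ∀ {x k} → Degree GP (centre-flag x) k → TileEdges GT x k
    TileEdges-centre-flag {x} = HasSize-transport centre-flag⁻¹ centre-flag
      (subst (λ y → SameTile GT y _) (retraction x)
        ∘ orbit-mapᴵ centre-flag⁻¹ AtCentre centre-closed
            ((λ {x} → comm1 x) ∷ (λ {x} → comm2 x) ∷ []) (at-centre x))
      (orbit-map centre-flag ((λ {x} _ → comm0⁻¹ x) ∷ (λ {x} _ → comm1⁻¹ x) ∷ []))
      (λ o → section _ (orbit-preserves AtCentre centre-closed (at-centre x) o))
      (λ _ → retraction _)
      where
      at-centre : ∀ x → AtCentre (centre-flag x)
      at-centre (_ , true) = refl
      at-centre (_ , false) = refl
      comm1 : ∀ x → AtCentre x → centre-flag⁻¹ (GP.r1 x) ≡ GT.r0 (centre-flag⁻¹ x)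
      comm1 ((d , i4) , true) refl = cong (_, false) (σσ⁻ (α d))
      comm1 ((_ , i4) , false) refl = refl
      comm2 : ∀ x → AtCentre x → centre-flag⁻¹ (GP.r2 x) ≡ GT.r1 (centre-flag⁻¹ x)
      comm2 ((_ , i4) , true) refl = refl
      comm2 ((d , i4) , false) refl = cong (_, true) (sym (σ⁻σ d))
      comm0⁻¹ : ∀ x → centre-flag (GT.r0 x) ≡ GP.r1 (centre-flag x)
      comm0⁻¹ (_ , true) = refl
      comm0⁻¹ (d , false) = cong (λ z → (α z , i4) , true) (sym (σσ⁻ d))
      comm1⁻¹ : ∀ x → centre-flag (GT.r1 x) ≡ GP.r2 (centre-flag x)
      comm1⁻¹ (d , true) = cong (λ z → (z , i4) , false) (σ⁻σ d)
      comm1⁻¹ (_ , false) = refl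
      section : ∀ x → AtCentre x → centre-flag (centre-flag⁻¹ x) ≡ x
      section ((_ , i4) , true) refl = refl
      section ((d , i4) , false) refl = cong (λ z → (z , i4) , false) (σ⁻σ d)
      retraction : ∀ x → centre-flag⁻¹ (centre-flag x) ≡ x
      retraction (_ , true) = refl
      retraction (d , false) = cong (_, false) (σσ⁻ d)

    private
      Connected-forget : ∀ {x y} → Orbit (GP.r0 ∷ GP.r1 ∷ GP.r2 ∷ []) x y →
                         Orbit (GT.r0 ∷ GT.r1 ∷ GT.r2 ∷ []) (vertex-flag⁻¹ x) (vertex-flag⁻¹ y)
      Connected-forget = orbit-image vertex-flag⁻¹ traced
        where
        s0 s1 s2 : ∀ x → Orbit (GT.r0 ∷ GT.r1 ∷ GT.r2 ∷ []) x _
        s0 = orbit-step (here refl)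
        s1 = orbit-step (there (here refl))
        s2 = orbit-step (there (there (here refl)))
        traced : ∀ {f} → f ∈ (GP.r0 ∷ GP.r1 ∷ GP.r2 ∷ []) →
                 ∀ x → Orbit (GT.r0 ∷ GT.r1 ∷ GT.r2 ∷ []) (vertex-flag⁻¹ x) (vertex-flag⁻¹ (f x))
        traced (here refl) ((_ , i2) , _) = s0 _
        traced (here refl) ((_ , i0) , _) = s2 _
        traced (here refl) ((_ , i1) , _) = s2 _
        traced (here refl) ((_ , i3) , _) = s2 _
        traced (here refl) ((_ , i4) , _) = s2 _
        traced (there (here refl)) ((_ , i0) , true) = s1 _
        traced (there (here refl)) ((_ , i0) , false) = s1 _
        traced (there (here refl)) ((_ , i4) , true) = orbit-trans (orbit-trans (s0 _) (s1 _)) (s2 _)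
        traced (there (here refl)) ((_ , i4) , false) = orbit-trans (orbit-trans (s2 _) (s1 _)) (s0 _)
        traced (there (here refl)) ((_ , i1) , true) = s2 _
        traced (there (here refl)) ((_ , i1) , false) = s2 _
        traced (there (here refl)) ((_ , i2) , true) = s2 _
        traced (there (here refl)) ((_ , i2) , false) = s2 _
        traced (there (here refl)) ((_ , i3) , true) = s2 _
        traced (there (here refl)) ((_ , i3) , false) = s2 _
        traced (there (there (here refl))) _ = s2 _

    IsTiling-unsubdivide : IsTiling GP → IsTiling GT
    IsTiling-unsubdivide (_ , connected , degrees , _) =
        toGMap-isGMap
      , (λ x y → Connected-forget (connected (vertex-flag x) (vertex-flag y)))
      , (λ x → let k , 3≤k , deg = degrees (vertex-flag x) in
                 k , 3≤k , Degree-vertex-flag {k = k} deg)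
      , (λ x → let k , 3≤k , deg = degrees (centre-flag x) in
                 k , 3≤k , TileEdges-centre-flag {k = k} deg)

pattern k0 = Fin.zero
pattern k1 = Fin.suc k0
pattern k2 = Fin.suc k1
pattern k3 = Fin.suc k2
pattern k4 = Fin.suc k3
pattern k5 = Fin.suc k4
pattern k6 = Fin.suc k5
pattern k7 = Fin.suc k6
pattern k8 = Fin.suc k7
pattern k9 = Fin.suc k8

-- corners of a pentagon are numbered along its boundary walk, from the vertex of the first flag
corner : Fin 10 → ℕ
corner k0 = 0
corner k1 = 1
corner k2 = 1
corner k3 = 2
corner k4 = 2
corner k5 = 3
corner k6 = 3
corner k7 = 4
corner k8 = 4
corner k9 = 0

partner : Fin 10 → Fin 10
partner k0 = k9
partner k1 = k2
partner k2 = k1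
partner k3 = k4
partner k4 = k3
partner k5 = k6
partner k6 = k5
partner k7 = k8
partner k8 = k7
partner k9 = k0

corner-partner : ∀ k → corner (partner k) ≡ corner k
corner-partner k0 = refl
corner-partner k1 = refl
corner-partner k2 = refl
corner-partner k3 = refl
corner-partner k4 = refl
corner-partner k5 = refl
corner-partner k6 = refl
corner-partner k7 = refl
corner-partner k8 = refl
corner-partner k9 = refl

exactly-one : ∀ a b → a ≡ true ⊎ b ≡ true → (a ≡ true → b ≡ true → ⊥) → b ≡ not a
exactly-one true true _ not-both = ⊥-elim (not-both refl refl)
exactly-one true false _ _ = refl
exactly-one false true _ _ = refl
exactly-one false false (inj₁ ()) _
exactly-one false false (inj₂ ()) _

false≢true : false ≢ true
false≢true ()

module Recognition {A : Set} (M : GMap A) (tiling : IsTiling M) (pentagonal : Pentagonal M)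
                   (non-degenerate : ∀ x → NonDegenerateTile M x)
                   (ℓ : A → Bool) (labelling : CircLabelling M ℓ) where
  open GMap M

  r0-involutive : Involutive _≡_ r0
  r0-involutive = proj₁ (proj₁ tiling)
  r1-involutive : Involutive _≡_ r1
  r1-involutive = proj₁ (proj₂ (proj₁ tiling))
  r2-involutive : Involutive _≡_ r2
  r2-involutive = proj₁ (proj₂ (proj₂ (proj₁ tiling)))
  r0-free : ∀ x → r0 x ≢ x
  r0-free = proj₁ (proj₂ (proj₂ (proj₂ (proj₁ tiling))))
  r1-free : ∀ x → r1 x ≢ x
  r1-free = proj₁ (proj₂ (proj₂ (proj₂ (proj₂ (proj₁ tiling)))))
  r2-free : ∀ x → r2 x ≢ x
  r2-free = proj₁ (proj₂ (proj₂ (proj₂ (proj₂ (proj₂ (proj₁ tiling))))))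
  r0r2-comm : ∀ x → r0 (r2 x) ≡ r2 (r0 x)
  r0r2-comm = proj₁ (proj₂ (proj₂ (proj₂ (proj₂ (proj₂ (proj₂ (proj₁ tiling)))))))
  r0r2-free : ∀ x → r0 (r2 x) ≢ x
  r0r2-free = proj₂ (proj₂ (proj₂ (proj₂ (proj₂ (proj₂ (proj₂ (proj₁ tiling)))))))

  open AlternatingWalk r0 r1 r0-involutive r1-involutive r0-free r1-free public
  module Star = AlternatingWalk r1 r2 r1-involutive r2-involutive r1-free r2-free

  ℓ-vertex : ∀ {x y} → SameVertex M x y → ℓ x ≡ ℓ y
  ℓ-vertex = proj₁ labelling _ _

  ℓ-r1 : ∀ x → ℓ (r1 x) ≡ ℓ x
  ℓ-r1 x = sym (ℓ-vertex (orbit-step (here refl) x))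

  ℓ-r2 : ∀ x → ℓ (r2 x) ≡ ℓ x
  ℓ-r2 x = sym (ℓ-vertex (orbit-step (there (here refl)) x))

  ℓ-r0r2 : ∀ x → ℓ (r0 (r2 x)) ≡ ℓ (r0 x)
  ℓ-r0r2 x = trans (cong ℓ (r0r2-comm x)) (ℓ-r2 (r0 x))

  ∘-same-vertex : ∀ {y z} → ℓ y ≡ true → ℓ z ≡ true → SameTile M y z → SameVertex M y z
  ∘-same-vertex {y} {z} ∘y ∘z y~z with proj₁ (proj₂ labelling) y
  ... | w , _ , _ , unique = orbit-trans (orbit-sym Star.ab-involutive (unique y here ∘y)) (unique z y~z ∘z)

  walk-10 : ∀ y → walk y 10 ≡ y
  walk-10 y = walk-period (pentagonal y)

  walk-9 : ∀ y → walk y 9 ≡ r1 y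
  walk-9 y = trans (sym (r1-involutive _)) (cong r1 (walk-10 y))

  walk-onto-10 : ∀ y {x} → SameTile M y x → Σ (Fin 10) λ k → walk y (toℕ k) ≡ x
  walk-onto-10 y y~x with walk-onto (pentagonal y) y~x
  ... | k , k<10 , e = Fin.fromℕ< k<10 , trans (cong (walk y) (Finₚ.toℕ-fromℕ< k<10)) e

  walk-injective-10 : ∀ y {i j : Fin 10} → walk y (toℕ i) ≡ walk y (toℕ j) → i ≡ j
  walk-injective-10 y {i} {j} e =
    Finₚ.toℕ-injective (walk-injective (pentagonal y) (Finₚ.toℕ<n i) (Finₚ.toℕ<n j) e)

  walk-same-tile : ∀ y i j → SameTile M (walk y i) (walk y j)
  walk-same-tile y i j = orbit-trans (orbit-sym ab-involutive (walk-in-orbit y i)) (walk-in-orbit y j)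

  r1-walk : ∀ y k → r1 (walk y (toℕ k)) ≡ walk y (toℕ (partner k))
  r1-walk y k0 = sym (walk-9 y)
  r1-walk y k1 = refl
  r1-walk y k2 = r1-involutive _
  r1-walk y k3 = refl
  r1-walk y k4 = r1-involutive _
  r1-walk y k5 = refl
  r1-walk y k6 = r1-involutive _
  r1-walk y k7 = refl
  r1-walk y k8 = r1-involutive _
  r1-walk y k9 = walk-10 y

  tile-∘ : ∀ y → Σ (Fin 10) λ k → ℓ (walk y (toℕ k)) ≡ true
  tile-∘ y with proj₁ (proj₂ labelling) y
  ... | w , y~w , ∘w , _ = let k , e = walk-onto-10 y y~w in k , trans (cong ℓ e) ∘w

  ∘-same-corner : ∀ y {i j} → ℓ (walk y (toℕ i)) ≡ true → ℓ (walk y (toℕ j)) ≡ true →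
                  corner i ≡ corner j
  ∘-same-corner y {i} {j} ∘i ∘j
    with non-degenerate _ _ _ here i~j (∘-same-vertex ∘i ∘j i~j)
    where i~j = walk-same-tile y (toℕ i) (toℕ j)
  ... | inj₁ j≡i = cong corner (walk-injective-10 y {i} {j} (sym j≡i))
  ... | inj₂ j≡partner = trans (sym (corner-partner i))
    (cong corner (walk-injective-10 y {partner i} {j} (sym (trans j≡partner (r1-walk y i)))))

  ∘-only-at-corner0 : ∀ y k → ℓ y ≡ true → corner k ≢ 0 → ℓ (walk y (toℕ k)) ≡ false
  ∘-only-at-corner0 y k ∘y k≢0 with ℓ (walk y (toℕ k)) in ∘k
  ... | false = refl
  ... | true = ⊥-elim (k≢0 (sym (∘-same-corner y {k0} {k} ∘y ∘k)))

  braid : ∀ x → ℓ x ≡ false → r1 (r2 (r1 x)) ≡ r2 (r1 (r2 x))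
  braid x ∘x = begin
    r1 (r2 (r1 x))                                   ≡⟨ undo (r1 (r2 (r1 x))) ⟨
    r2 (r1 (r2 (r2 (r1 (r2 (r1 (r2 (r1 x))))))))     ≡⟨ cong (r2 ∘ r1 ∘ r2) (Star.walk-period degree-3) ⟩
    r2 (r1 (r2 x))                                   ∎
    where
    open ≡-Reasoning
    degree-3 : Degree M x 3
    degree-3 = proj₂ (proj₂ labelling) x x here ∘x
    undo : ∀ w → r2 (r1 (r2 (r2 (r1 (r2 w))))) ≡ w
    undo w = trans (cong (r2 ∘ r1) (r2-involutive _)) (trans (cong r2 (r1-involutive _)) (r2-involutive w))

  walk-6 : ∀ y → walk y 6 ≡ r0 (r1 (r0 (walk y 9)))
  walk-6 y = sym (trans (cong (r0 ∘ r1) (r0-involutive _)) (trans (cong r0 (r1-involutive _)) (r0-involutive _)))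

  -- For a ∘-flag e the corner 2 of its tile has degree 3, and α̂ e is the flag at the far end
  -- of the third edge there.  Whether that end is a ∘-vertex tells apart the ∘-flags e and r1 e.
  α̂ : A → A
  α̂ e = r0 (r1 (r2 (walk e 3)))

  positive : A → Bool
  positive e = ℓ (α̂ e)

  -- The tile q across the edge between the corners 1 and 2 of the tile of e has no ∘-flag except
  -- possibly at its corner 2, labelled positive e, and at its corner 3, labelled positive (r2 e).
  module AcrossR2 (e : A) (∘e : ℓ e ≡ true) where
    q : ℕ → A
    q = walk (r2 (walk e 2))

    ℓq0 : ℓ (q 0) ≡ false
    ℓq0 = trans (ℓ-r2 _) (∘-only-at-corner0 e k2 ∘e λ ())
    ℓq1 : ℓ (q 1) ≡ false
    ℓq1 = trans (ℓ-r0r2 _) (∘-only-at-corner0 e k3 ∘e λ ())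
    ℓq2 : ℓ (q 2) ≡ false
    ℓq2 = trans (ℓ-r1 _) ℓq1
    ℓq3 : ℓ (q 3) ≡ positive e
    ℓq3 = cong (ℓ ∘ r0 ∘ r1) (r0r2-comm _)
    ℓq4 : ℓ (q 4) ≡ positive e
    ℓq4 = trans (ℓ-r1 _) ℓq3
    q9 : q 9 ≡ r2 (walk (r2 e) 2)
    q9 = trans (walk-9 _) (trans (braid (r0 e) (∘-only-at-corner0 e k1 ∘e λ ())) (cong (r2 ∘ r1) (sym (r0r2-comm e))))
    ℓq9 : ℓ (q 9) ≡ false
    ℓq9 = trans (cong ℓ (walk-9 _)) (trans (ℓ-r1 _) ℓq0)
    ℓq8 : ℓ (q 8) ≡ false
    ℓq8 = trans (cong ℓ (trans (walk-back _ 8) (cong r0 q9)))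
                (trans (ℓ-r0r2 _) (∘-only-at-corner0 (r2 e) k3 (trans (ℓ-r2 e) ∘e) λ ()))
    ℓq7 : ℓ (q 7) ≡ false
    ℓq7 = trans (sym (ℓ-r1 _)) ℓq8
    ℓq6 : ℓ (q 6) ≡ positive (r2 e)
    ℓq6 = cong ℓ (trans (walk-6 _) (trans (cong (r0 ∘ r1 ∘ r0) q9) (cong (r0 ∘ r1) (r0r2-comm _))))
    ℓq5 : ℓ (q 5) ≡ positive (r2 e)
    ℓq5 = trans (sym (ℓ-r1 _)) ℓq6

    some-positive : positive e ≡ true ⊎ positive (r2 e) ≡ true
    some-positive with tile-∘ (r2 (walk e 2))
    ... | k0 , h = ⊥-elim (false≢true (trans (sym ℓq0) h))
    ... | k1 , h = ⊥-elim (false≢true (trans (sym ℓq1) h))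
    ... | k2 , h = ⊥-elim (false≢true (trans (sym ℓq2) h))
    ... | k3 , h = inj₁ (trans (sym ℓq3) h)
    ... | k4 , h = inj₁ (trans (sym ℓq4) h)
    ... | k5 , h = inj₂ (trans (sym ℓq5) h)
    ... | k6 , h = inj₂ (trans (sym ℓq6) h)
    ... | k7 , h = ⊥-elim (false≢true (trans (sym ℓq7) h))
    ... | k8 , h = ⊥-elim (false≢true (trans (sym ℓq8) h))
    ... | k9 , h = ⊥-elim (false≢true (trans (sym ℓq9) h))

    not-both-positive : positive e ≡ true → positive (r2 e) ≡ true → ⊥
    not-both-positive s s′ =
      contradiction (∘-same-corner (r2 (walk e 2)) {k3} {k6} (trans ℓq3 s) (trans ℓq6 s′)) λ ()

  positive-r2 : ∀ e → ℓ e ≡ true → positive (r2 e) ≡ not (positive e)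
  positive-r2 e ∘e = exactly-one _ _ some-positive not-both-positive
    where open AcrossR2 e ∘e

  -- The tile v across the edge between the corners 2 and 3 of the tile of e is labelled
  -- positive (r1 e) at its corner 2 and positive e at its corner 4.  If both are false, its
  -- ∘-corner is 3, and then the tile w beyond q and v has ∘-flags at its corners 1 and 4.
  module AcrossR1 (e : A) (∘e : ℓ e ≡ true) where
    open AcrossR2 e ∘e using (q; ℓq3; ℓq6)

    v : ℕ → A
    v = walk (r2 (walk e 4))

    ℓv0 : ℓ (v 0) ≡ false
    ℓv0 = trans (ℓ-r2 _) (∘-only-at-corner0 e k4 ∘e λ ())
    ℓv1 : ℓ (v 1) ≡ false
    ℓv1 = trans (ℓ-r0r2 _) (∘-only-at-corner0 e k5 ∘e λ ())
    ℓv2 : ℓ (v 2) ≡ false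
    ℓv2 = trans (ℓ-r1 _) ℓv1
    ℓv3 : ℓ (v 3) ≡ positive (r1 e)
    ℓv3 = sym (begin
      ℓ (r0 (r1 (r2 (walk (r1 e) 3))))    ≡⟨ cong (λ z → ℓ (r0 (r1 (r2 z)))) walk-r1-3 ⟩
      ℓ (r0 (r1 (r2 (r1 (walk e 5)))))    ≡⟨ cong (ℓ ∘ r0) (braid (walk e 5) (∘-only-at-corner0 e k5 ∘e λ ())) ⟩
      ℓ (r0 (r2 (r1 (r2 (walk e 5)))))    ≡⟨ ℓ-r0r2 _ ⟩
      ℓ (r0 (r1 (r2 (walk e 5))))         ≡⟨ cong (ℓ ∘ r0 ∘ r1) (r0r2-comm _) ⟨
      ℓ (v 3)                             ∎)
      where
      open ≡-Reasoning
      walk-r1-3 : walk (r1 e) 3 ≡ walk e 6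
      walk-r1-3 = sym (trans (walk-6 e) (cong (r0 ∘ r1 ∘ r0) (walk-9 e)))
    ℓv4 : ℓ (v 4) ≡ positive (r1 e)
    ℓv4 = trans (ℓ-r1 _) ℓv3
    v9 : v 9 ≡ r2 (r1 (r2 (walk e 3)))
    v9 = trans (walk-9 _) (braid (walk e 3) (∘-only-at-corner0 e k3 ∘e λ ()))
    v8 : v 8 ≡ r2 (r0 (r1 (r2 (walk e 3))))
    v8 = trans (walk-back _ 8) (trans (cong r0 v9) (r0r2-comm _))
    ℓv8 : ℓ (v 8) ≡ positive e
    ℓv8 = trans (cong ℓ v8) (ℓ-r2 _)
    ℓv7 : ℓ (v 7) ≡ positive e
    ℓv7 = trans (sym (ℓ-r1 _)) ℓv8
    ℓv9 : ℓ (v 9) ≡ false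
    ℓv9 = trans (cong ℓ (walk-9 _)) (trans (ℓ-r1 _) ℓv0)

    not-both-positive : positive e ≡ true → positive (r1 e) ≡ true → ⊥
    not-both-positive s s′ =
      contradiction (∘-same-corner (r2 (walk e 4)) {k3} {k8} (trans ℓv3 s′) (trans ℓv8 s)) λ ()

    ℓv6 : positive e ≡ false → positive (r1 e) ≡ false → ℓ (v 6) ≡ true
    ℓv6 s s′ with tile-∘ (r2 (walk e 4))
    ... | k0 , h = ⊥-elim (false≢true (trans (sym ℓv0) h))
    ... | k1 , h = ⊥-elim (false≢true (trans (sym ℓv1) h))
    ... | k2 , h = ⊥-elim (false≢true (trans (sym ℓv2) h))
    ... | k3 , h = ⊥-elim (false≢true (trans (sym (trans ℓv3 s′)) h))
    ... | k4 , h = ⊥-elim (false≢true (trans (sym (trans ℓv4 s′)) h))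
    ... | k5 , h = trans (ℓ-r1 _) h
    ... | k6 , h = h
    ... | k7 , h = ⊥-elim (false≢true (trans (sym (trans ℓv7 s)) h))
    ... | k8 , h = ⊥-elim (false≢true (trans (sym (trans ℓv8 s)) h))
    ... | k9 , h = ⊥-elim (false≢true (trans (sym ℓv9) h))

    not-neither-positive : positive e ≡ false → positive (r1 e) ≡ false → ⊥
    not-neither-positive s s′ = contradiction (∘-same-corner (r2 (q 4)) {k1} {k8} ℓw1 ℓw8) λ ()
      where
      w : ℕ → A
      w = walk (r2 (q 4))
      ℓw1 : ℓ (w 1) ≡ true
      ℓw1 = trans (ℓ-r0r2 _) (trans (sym (ℓ-r1 _)) (trans ℓq6 (trans (positive-r2 e ∘e) (cong not s))))
      r2q3 : r2 (q 3) ≡ v 8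
      r2q3 = trans (cong (r2 ∘ r0 ∘ r1) (r0r2-comm _)) (sym v8)
      w9 : w 9 ≡ r2 (v 7)
      w9 = trans (walk-9 _) (trans (braid (q 3) (trans ℓq3 s))
                 (trans (cong (r2 ∘ r1) r2q3) (cong r2 (r1-involutive (v 7)))))
      ℓw8 : ℓ (w 8) ≡ true
      ℓw8 = trans (cong ℓ (trans (walk-back _ 8) (trans (cong r0 w9) (r0r2-comm _))))
                  (trans (ℓ-r2 _) (trans (cong ℓ (r0-involutive (v 6))) (ℓv6 s s′)))

    some-positive : positive e ≡ true ⊎ positive (r1 e) ≡ true
    some-positive with positive e in s | positive (r1 e) in s′
    ... | true  | _     = inj₁ refl
    ... | false | true  = inj₂ refl
    ... | false | false = ⊥-elim (not-neither-positive s s′)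

  positive-r1 : ∀ e → ℓ e ≡ true → positive (r1 e) ≡ not (positive e)
  positive-r1 e ∘e = exactly-one _ _ some-positive not-both-positive
    where open AcrossR1 e ∘e

  σ̂ σ̂⁻ : A → A
  σ̂ e = r1 (r2 e)
  σ̂⁻ e = r2 (r1 e)

  σ̂-σ̂⁻ : ∀ e → σ̂ (σ̂⁻ e) ≡ e
  σ̂-σ̂⁻ e = trans (cong r1 (r2-involutive _)) (r1-involutive e)

  σ̂⁻-σ̂ : ∀ e → σ̂⁻ (σ̂ e) ≡ e
  σ̂⁻-σ̂ e = trans (cong r2 (r1-involutive _)) (r2-involutive e)

  walk-α̂-3 : ∀ e → walk (α̂ e) 3 ≡ r2 (walk e 2)
  walk-α̂-3 e = begin
    r0 (r1 (r0 (r0 (r1 (r2 (walk e 3))))))   ≡⟨ cong (r0 ∘ r1) (r0-involutive _) ⟩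
    r0 (r1 (r1 (r2 (walk e 3))))             ≡⟨ cong r0 (r1-involutive _) ⟩
    r0 (r2 (r0 (walk e 2)))                  ≡⟨ r0r2-comm _ ⟩
    r2 (r0 (r0 (walk e 2)))                  ≡⟨ cong r2 (r0-involutive _) ⟩
    r2 (walk e 2)                            ∎
    where open ≡-Reasoning

  α̂-involutive : Involutive _≡_ α̂
  α̂-involutive e = begin
    r0 (r1 (r2 (walk (α̂ e) 3)))   ≡⟨ cong (r0 ∘ r1 ∘ r2) (walk-α̂-3 e) ⟩
    r0 (r1 (r2 (r2 (walk e 2))))   ≡⟨ cong (r0 ∘ r1) (r2-involutive _) ⟩
    r0 (r1 (r1 (r0 e)))            ≡⟨ cong r0 (r1-involutive _) ⟩
    r0 (r0 e)                      ≡⟨ r0-involutive e ⟩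
    e                              ∎
    where open ≡-Reasoning

  α̂-free : ∀ e → α̂ e ≢ e
  α̂-free e α̂e≡e = r0r2-free (walk e 2) (begin
    r0 (r2 (walk e 2))         ≡⟨ cong r0 (walk-α̂-3 e) ⟨
    r0 (walk (α̂ e) 3)          ≡⟨ cong (λ x → r0 (walk x 3)) α̂e≡e ⟩
    r0 (r0 (walk e 2))         ≡⟨ r0-involutive _ ⟩
    walk e 2                   ∎)
    where open ≡-Reasoning

  IsDart : A → Set
  IsDart e = ℓ e ≡ true × positive e ≡ true

  IsDart-α̂ : ∀ {e} → IsDart e → IsDart (α̂ e)
  IsDart-α̂ (∘e , +e) = +e , trans (cong ℓ (α̂-involutive _)) ∘e

  IsDart-σ̂ : ∀ {e} → IsDart e → IsDart (σ̂ e)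
  IsDart-σ̂ {e} (∘e , +e) = trans (ℓ-r1 _) (trans (ℓ-r2 e) ∘e)
    , trans (positive-r1 (r2 e) (trans (ℓ-r2 e) ∘e)) (cong not (trans (positive-r2 e ∘e) (cong not +e)))

  IsDart-σ̂⁻ : ∀ {e} → IsDart e → IsDart (σ̂⁻ e)
  IsDart-σ̂⁻ {e} (∘e , +e) = trans (ℓ-r2 _) (trans (ℓ-r1 e) ∘e)
    , trans (positive-r2 (r1 e) (trans (ℓ-r1 e) ∘e)) (cong not (trans (positive-r1 e ∘e) (cong not +e)))

  neighbour : Fin 10 → A → A
  neighbour k0 = σ̂
  neighbour k1 = σ̂
  neighbour k2 = α̂
  neighbour k3 = α̂
  neighbour k4 = σ̂ ∘ α̂
  neighbour k5 = σ̂ ∘ α̂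
  neighbour k6 = α̂ ∘ σ̂⁻
  neighbour k7 = α̂ ∘ σ̂⁻
  neighbour k8 = σ̂⁻
  neighbour k9 = σ̂⁻

  mirror : Fin 10 → Fin 10
  mirror k0 = k9
  mirror k1 = k8
  mirror k2 = k3
  mirror k3 = k2
  mirror k4 = k7
  mirror k5 = k6
  mirror k6 = k5
  mirror k7 = k4
  mirror k8 = k1
  mirror k9 = k0

  private
    r2-r0 : ∀ {w z} → r2 w ≡ r0 z → r2 (r0 w) ≡ z
    r2-r0 {w} {z} e = trans (sym (r0r2-comm w)) (trans (cong r0 e) (r0-involutive z))

    r2-walk-0 : ∀ e → r2 e ≡ walk (σ̂ e) 9
    r2-walk-0 e = sym (trans (walk-9 _) (r1-involutive _))

    r2-walk-3 : ∀ e → r2 (walk e 3) ≡ walk (α̂ e) 2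
    r2-walk-3 e = sym (trans (cong r1 (r0-involutive _)) (r1-involutive _))

    r2-walk-4 : ∀ e → ℓ e ≡ true → r2 (walk e 4) ≡ walk (σ̂ (α̂ e)) 7
    r2-walk-4 e ∘e = begin
      r2 (r1 y)                               ≡⟨ cong (r2 ∘ r1) (r2-involutive y) ⟨
      r2 (r1 (r2 (r2 y)))                     ≡⟨ braid (r2 y) (trans (ℓ-r2 y) (∘-only-at-corner0 e k3 ∘e λ ())) ⟨
      r1 (r2 (r1 (r2 y)))                     ≡⟨ cong (r1 ∘ r2 ∘ r1) (r2-walk-3 e) ⟩
      r1 (r2 (r1 (r1 (r0 (α̂ e)))))            ≡⟨ cong (r1 ∘ r2) (r1-involutive _) ⟩
      r1 (r2 (r0 (α̂ e)))                      ≡⟨ cong r1 (r0r2-comm _) ⟨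
      r1 (r0 (r2 (α̂ e)))                      ≡⟨ cong (r1 ∘ r0) (r2-walk-0 (α̂ e)) ⟩
      r1 (r0 (r0 (walk (σ̂ (α̂ e)) 8)))         ≡⟨ cong r1 (r0-involutive _) ⟩
      r1 (r1 (walk (σ̂ (α̂ e)) 7))              ≡⟨ r1-involutive _ ⟩
      walk (σ̂ (α̂ e)) 7                        ∎
      where
      open ≡-Reasoning
      y = walk e 3

    σ̂α̂α̂σ̂⁻ : ∀ e → σ̂ (α̂ (α̂ (σ̂⁻ e))) ≡ e
    σ̂α̂α̂σ̂⁻ e = trans (cong σ̂ (α̂-involutive _)) (σ̂-σ̂⁻ e)

    r2-flip : ∀ {x y} → r2 x ≡ y → r2 y ≡ x
    r2-flip = involutive-flip r2-involutive ∘ sym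

  r2-walk : ∀ {e} → IsDart e → ∀ k → r2 (walk e (toℕ k)) ≡ walk (neighbour k e) (toℕ (mirror k))
  r2-walk {e} _ k0 = r2-walk-0 e
  r2-walk {e} _ k1 = r2-r0 (r2-walk-0 e)
  r2-walk {e} _ k2 = sym (walk-α̂-3 e)
  r2-walk {e} _ k3 = r2-walk-3 e
  r2-walk {e} (∘e , _) k4 = r2-walk-4 e ∘e
  r2-walk {e} (∘e , _) k5 = r2-r0 (r2-walk-4 e ∘e)
  r2-walk {e} d k6 =
    r2-flip (trans (r2-r0 (r2-walk-4 _ (proj₂ (IsDart-σ̂⁻ d)))) (cong (λ x → walk x 6) (σ̂α̂α̂σ̂⁻ e)))
  r2-walk {e} d k7 =
    r2-flip (trans (r2-walk-4 _ (proj₂ (IsDart-σ̂⁻ d))) (cong (λ x → walk x 7) (σ̂α̂α̂σ̂⁻ e)))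
  r2-walk {e} _ k8 = trans (cong r2 (trans (walk-back e 8) (cong r0 (walk-9 e)))) (sym (r0r2-comm _))
  r2-walk {e} _ k9 = cong r2 (walk-9 e)

  dart-walk-onto : ∀ x → Σ A λ e → IsDart e × Σ (Fin 10) λ k → walk e (toℕ k) ≡ x
  dart-walk-onto x with proj₁ (proj₂ labelling) x
  ... | y , x~y , ∘y , _ with positive y in +y
  ...   | true  = y , (∘y , +y) , walk-onto-10 y (orbit-sym ab-involutive x~y)
  ...   | false = r1 y , (trans (ℓ-r1 y) ∘y , trans (positive-r1 y ∘y) (cong not +y)) , walk-onto-10 (r1 y) r1y~x
    where
    r1y~x : SameTile M (r1 y) x
    r1y~x = orbit-sym ab-involutive (orbit-trans x~y (orbit-step (there (here refl)) y))

  dart-unique-in-tile : ∀ {e e′} → IsDart e → IsDart e′ → SameTile M e e′ → e ≡ e′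
  dart-unique-in-tile {e} d d′ e~e′ with walk-onto-10 e e~e′
  ... | j , refl = at-corner0 j (∘-same-corner e {k0} {j} (proj₁ d) (proj₁ d′)) d′
    where
    at-corner0 : ∀ j → 0 ≡ corner j → IsDart (walk e (toℕ j)) → e ≡ walk e (toℕ j)
    at-corner0 k0 _ _ = refl
    at-corner0 k9 _ (_ , +e9) = ⊥-elim (false≢true (begin
      false                ≡⟨ cong not (proj₂ d) ⟨
      not (positive e)     ≡⟨ positive-r1 e (proj₁ d) ⟨
      positive (r1 e)      ≡⟨ cong positive (walk-9 e) ⟨
      positive (walk e 9)  ≡⟨ +e9 ⟩
      true                 ∎))
      where open ≡-Reasoning
    at-corner0 k1 () _
    at-corner0 k2 () _
    at-corner0 k3 () _
    at-corner0 k4 () _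
    at-corner0 k5 () _
    at-corner0 k6 () _
    at-corner0 k7 () _
    at-corner0 k8 () _

  dart-walk-injective : ∀ {e e′ k k′} → IsDart e → IsDart e′ → walk e (toℕ k) ≡ walk e′ (toℕ k′) →
                        e ≡ e′ × k ≡ k′
  dart-walk-injective {e} {e′} {k} {k′} d d′ h with dart-unique-in-tile d d′ e~e′
    where
    e~e′ : SameTile M e e′
    e~e′ = orbit-trans (walk-in-orbit e (toℕ k))
             (subst (λ z → SameTile M z e′) (sym h) (orbit-sym ab-involutive (walk-in-orbit e′ (toℕ k′))))
  ... | refl = refl , walk-injective-10 e h

module Enumeration {n : ℕ} {P : Fin n → Set} (P? : Decidable P) where
  abstract
    private
      elements : List (Fin n)
      elements = filter P? (allFin n)

    size : ℕ
    size = length elements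

    decode : Fin size → Fin n
    decode = lookup elements

    decode-sound : ∀ i → P (decode i)
    decode-sound i = proj₂ (∈-filter⁻ P? {xs = allFin n} (∈-lookup i))

    encode : ∀ x → P x → Fin size
    encode x Px = index (∈-filter⁺ P? (∈-allFin x) Px)

    decode-encode : ∀ x (Px : P x) → decode (encode x Px) ≡ x
    decode-encode x Px = sym (lookup-index (∈-filter⁺ P? (∈-allFin x) Px))

    decode-injective : ∀ {i j} → decode i ≡ decode j → i ≡ j
    decode-injective = lookup-injective (Uniqueₚ.filter⁺ P? (Uniqueₚ.allFin⁺ n)) _ _

module Unsubdivision {n : ℕ} (M : GMap (Fin n)) (tiling : IsTiling M) (pentagonal : Pentagonal M)
                     (non-degenerate : ∀ x → NonDegenerateTile M x)
                     (ℓ : Fin n → Bool) (labelling : CircLabelling M ℓ) where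
  open GMap M
  open Recognition M tiling pentagonal non-degenerate ℓ labelling
  open Enumeration (λ e → (ℓ e Boolₚ.≟ true) ×-dec (positive e Boolₚ.≟ true)) public

  -- abstract, so that conversion checking never unfolds encode and its proofs of IsDart
  abstract
    Tσ Tσ⁻ Tα : Fin size → Fin size
    Tσ d = encode (σ̂ (decode d)) (IsDart-σ̂ (decode-sound d))
    Tσ⁻ d = encode (σ̂⁻ (decode d)) (IsDart-σ̂⁻ (decode-sound d))
    Tα d = encode (α̂ (decode d)) (IsDart-α̂ (decode-sound d))

    decode-Tσ : ∀ d → decode (Tσ d) ≡ σ̂ (decode d)
    decode-Tσ d = decode-encode _ _
    decode-Tσ⁻ : ∀ d → decode (Tσ⁻ d) ≡ σ̂⁻ (decode d)
    decode-Tσ⁻ d = decode-encode _ _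
    decode-Tα : ∀ d → decode (Tα d) ≡ α̂ (decode d)
    decode-Tα d = decode-encode _ _

  T : OMap (Fin size)
  T = record { σ = Tσ ; σ⁻ = Tσ⁻ ; α = Tα }

  Tσ-Tσ⁻ : ∀ d → Tσ (Tσ⁻ d) ≡ d
  Tσ-Tσ⁻ d = decode-injective (trans (decode-Tσ _) (trans (cong σ̂ (decode-Tσ⁻ d)) (σ̂-σ̂⁻ _)))
  Tσ⁻-Tσ : ∀ d → Tσ⁻ (Tσ d) ≡ d
  Tσ⁻-Tσ d = decode-injective (trans (decode-Tσ⁻ _) (trans (cong σ̂⁻ (decode-Tσ d)) (σ̂⁻-σ̂ _)))
  Tα-involutive : ∀ d → Tα (Tα d) ≡ d
  Tα-involutive d = decode-injective (trans (decode-Tα _) (trans (cong α̂ (decode-Tα d)) (α̂-involutive _)))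

  T-isOMap : IsOMap T
  T-isOMap = Tσ-Tσ⁻ , Tσ⁻-Tσ , Tα-involutive
           , λ d e → α̂-free (decode d) (trans (sym (decode-Tα d)) (cong decode e))

  Flag : Set
  Flag = (Fin size × Fin 5) × Bool

  -- the ten flags of T(5) around the pentagon of the dart d, in the order of the boundary walk
  -- of the tile of decode d in M
  pentagon-flag : Fin size → Fin 10 → Flag
  pentagon-flag d k0 = (d , i0) , false
  pentagon-flag d k1 = (d , i1) , true
  pentagon-flag d k2 = (d , i2) , false
  pentagon-flag d k3 = (Tα d , i2) , true
  pentagon-flag d k4 = (Tα d , i3) , false
  pentagon-flag d k5 = (Tα d , i4) , true
  pentagon-flag d k6 = (Tσ⁻ d , i4) , false
  pentagon-flag d k7 = (Tσ⁻ d , i3) , true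
  pentagon-flag d k8 = (Tσ⁻ d , i1) , false
  pentagon-flag d k9 = (Tσ⁻ d , i0) , true

  to : Flag → Fin n
  to ((d , i0) , false) = walk (decode d) 0
  to ((d , i1) , true)  = walk (decode d) 1
  to ((d , i2) , false) = walk (decode d) 2
  to ((d , i2) , true)  = walk (decode (Tα d)) 3
  to ((d , i3) , false) = walk (decode (Tα d)) 4
  to ((d , i4) , true)  = walk (decode (Tα d)) 5
  to ((d , i4) , false) = walk (decode (Tσ d)) 6
  to ((d , i3) , true)  = walk (decode (Tσ d)) 7
  to ((d , i1) , false) = walk (decode (Tσ d)) 8
  to ((d , i0) , true)  = walk (decode (Tσ d)) 9

  from : Fin n → Flag
  from x = let e , dart , k , _ = dart-walk-onto x in pentagon-flag (encode e dart) k

  to-pentagon-flag : ∀ d k → to (pentagon-flag d k) ≡ walk (decode d) (toℕ k)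
  to-pentagon-flag d k0 = refl
  to-pentagon-flag d k1 = refl
  to-pentagon-flag d k2 = refl
  to-pentagon-flag d k3 = cong (λ d′ → walk (decode d′) 3) (Tα-involutive d)
  to-pentagon-flag d k4 = cong (λ d′ → walk (decode d′) 4) (Tα-involutive d)
  to-pentagon-flag d k5 = cong (λ d′ → walk (decode d′) 5) (Tα-involutive d)
  to-pentagon-flag d k6 = cong (λ d′ → walk (decode d′) 6) (Tσ-Tσ⁻ d)
  to-pentagon-flag d k7 = cong (λ d′ → walk (decode d′) 7) (Tσ-Tσ⁻ d)
  to-pentagon-flag d k8 = cong (λ d′ → walk (decode d′) 8) (Tσ-Tσ⁻ d)
  to-pentagon-flag d k9 = cong (λ d′ → walk (decode d′) 9) (Tσ-Tσ⁻ d)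

  to-from : ∀ x → to (from x) ≡ x
  to-from x with dart-walk-onto x
  ... | e , dart , k , e≡x =
    trans (to-pentagon-flag _ k) (trans (cong (λ e′ → walk e′ (toℕ k)) (decode-encode e dart)) e≡x)

  from-walk : ∀ d k → from (walk (decode d) (toℕ k)) ≡ pentagon-flag d k
  from-walk d k with dart-walk-onto (walk (decode d) (toℕ k))
  ... | e , dart , k′ , e≡x with dart-walk-injective {k = k′} {k′ = k} dart (decode-sound d) e≡x
  ...   | refl , refl = cong (λ d′ → pentagon-flag d′ k) (decode-injective (decode-encode _ dart))

  from-to : ∀ p → from (to p) ≡ p
  from-to ((d , i0) , false) = from-walk d k0
  from-to ((d , i1) , true)  = from-walk d k1
  from-to ((d , i2) , false) = from-walk d k2
  from-to ((d , i2) , true)  = trans (from-walk (Tα d) k3) (cong (λ d′ → (d′ , i2) , true) (Tα-involutive d))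
  from-to ((d , i3) , false) = trans (from-walk (Tα d) k4) (cong (λ d′ → (d′ , i3) , false) (Tα-involutive d))
  from-to ((d , i4) , true)  = trans (from-walk (Tα d) k5) (cong (λ d′ → (d′ , i4) , true) (Tα-involutive d))
  from-to ((d , i4) , false) = trans (from-walk (Tσ d) k6) (cong (λ d′ → (d′ , i4) , false) (Tσ⁻-Tσ d))
  from-to ((d , i3) , true)  = trans (from-walk (Tσ d) k7) (cong (λ d′ → (d′ , i3) , true) (Tσ⁻-Tσ d))
  from-to ((d , i1) , false) = trans (from-walk (Tσ d) k8) (cong (λ d′ → (d′ , i1) , false) (Tσ⁻-Tσ d))
  from-to ((d , i0) , true)  = trans (from-walk (Tσ d) k9) (cong (λ d′ → (d′ , i0) , true) (Tσ⁻-Tσ d))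

  private
    GP = toGMap (pentSub T)
    module GP = GMap GP

    walk-≡ : ∀ {x y} k → x ≡ y → walk x k ≡ walk y k
    walk-≡ k = cong (λ w → walk w k)

    dart : ∀ d → IsDart (decode d)
    dart = decode-sound

    σ̂⁻-Tσ : ∀ d → σ̂⁻ (decode (Tσ d)) ≡ decode d
    σ̂⁻-Tσ d = trans (cong σ̂⁻ (decode-Tσ d)) (σ̂⁻-σ̂ _)

    α̂-Tα : ∀ d → α̂ (decode (Tα d)) ≡ decode d
    α̂-Tα d = trans (cong α̂ (decode-Tα d)) (α̂-involutive _)

    σ̂α̂-Tα : ∀ d → σ̂ (α̂ (decode (Tα d))) ≡ decode (Tσ d)
    σ̂α̂-Tα d = trans (cong σ̂ (α̂-Tα d)) (sym (decode-Tσ d))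

    α̂σ̂⁻-Tσ : ∀ d → α̂ (σ̂⁻ (decode (Tσ d))) ≡ decode (Tα d)
    α̂σ̂⁻-Tσ d = trans (cong α̂ (σ̂⁻-Tσ d)) (sym (decode-Tα d))

  to-r0 : ∀ p → to (GP.r0 p) ≡ r0 (to p)
  to-r0 ((d , i0) , false) = refl
  to-r0 ((d , i0) , true)  = sym (r0-involutive _)
  to-r0 ((d , i1) , true)  = sym (r0-involutive _)
  to-r0 ((d , i1) , false) = refl
  to-r0 ((d , i2) , false) = walk-≡ 3 (cong decode (Tα-involutive d))
  to-r0 ((d , i2) , true)  = sym (r0-involutive _)
  to-r0 ((d , i3) , false) = refl
  to-r0 ((d , i3) , true)  = sym (r0-involutive _)
  to-r0 ((d , i4) , true)  = sym (r0-involutive _)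
  to-r0 ((d , i4) , false) = refl

  to-r1 : ∀ p → to (GP.r1 p) ≡ r1 (to p)
  to-r1 ((d , i0) , true)  = sym (walk-10 _)
  to-r1 ((d , i0) , false) = trans (walk-≡ 9 (cong decode (Tσ-Tσ⁻ d))) (walk-9 _)
  to-r1 ((d , i1) , true)  = refl
  to-r1 ((d , i1) , false) = sym (r1-involutive _)
  to-r1 ((d , i2) , true)  = refl
  to-r1 ((d , i2) , false) = sym (r1-involutive _)
  to-r1 ((d , i3) , true)  = refl
  to-r1 ((d , i3) , false) = sym (r1-involutive _)
  to-r1 ((d , i4) , true)  = walk-≡ 6 (cong decode (Tσ-Tσ⁻ (Tα d)))
  to-r1 ((d , i4) , false) = trans (walk-≡ 5 (cong decode (Tα-involutive (Tσ d)))) (sym (r1-involutive _))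

  to-r2 : ∀ p → to (GP.r2 p) ≡ r2 (to p)
  to-r2 ((d , i0) , false) = trans (walk-≡ 9 (decode-Tσ d)) (sym (r2-walk (dart d) k0))
  to-r2 ((d , i1) , true)  = trans (walk-≡ 8 (decode-Tσ d)) (sym (r2-walk (dart d) k1))
  to-r2 ((d , i2) , false) = trans (walk-≡ 3 (decode-Tα d)) (sym (r2-walk (dart d) k2))
  to-r2 ((d , i2) , true)  = sym (trans (r2-walk (dart (Tα d)) k3) (walk-≡ 2 (α̂-Tα d)))
  to-r2 ((d , i3) , false) = sym (trans (r2-walk (dart (Tα d)) k4) (walk-≡ 7 (σ̂α̂-Tα d)))
  to-r2 ((d , i4) , true)  = sym (trans (r2-walk (dart (Tα d)) k5) (walk-≡ 6 (σ̂α̂-Tα d)))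
  to-r2 ((d , i4) , false) = sym (trans (r2-walk (dart (Tσ d)) k6) (walk-≡ 5 (α̂σ̂⁻-Tσ d)))
  to-r2 ((d , i3) , true)  = sym (trans (r2-walk (dart (Tσ d)) k7) (walk-≡ 4 (α̂σ̂⁻-Tσ d)))
  to-r2 ((d , i1) , false) = sym (trans (r2-walk (dart (Tσ d)) k8) (walk-≡ 1 (σ̂⁻-Tσ d)))
  to-r2 ((d , i0) , true)  = sym (trans (r2-walk (dart (Tσ d)) k9) (walk-≡ 0 (σ̂⁻-Tσ d)))

  T5≅M : GIso (toGMap (pentSub T)) M
  T5≅M = record { to = to ; from = from ; from-to = from-to ; to-from = to-from
                ; to-r0 = to-r0 ; to-r1 = to-r1 ; to-r2 = to-r2 }

theorem3p4 : (n : ℕ) (M : GMap (Fin n)) →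
    IsTiling M → Pentagonal M → (∀ x → NonDegenerateTile M x) →
    Σ (Fin n → Bool) (λ ℓ → CircLabelling M ℓ) →
    Orientable M ×
    ∃[ m ] Σ (OMap (Fin m)) (λ T →
    IsOMap T × IsTiling (toGMap T) × GIso (toGMap (pentSub T)) M)
theorem3p4 n M tiling pentagonal non-degenerate (ℓ , labelling) =
    Orientable-transport T5≅M (toGMap-orientable (pentSub T))
  , size , T , T-isOMap , IsTiling-unsubdivide T T-isOMap (IsTiling-reflect T5≅M tiling) , T5≅M
  where open Unsubdivision M tiling pentagonal non-degenerate ℓ labelling
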